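{- Let $S$ be the set of all sequents, and for $\Gamma\Rightarrow\Delta\in S$ let $M(\Gamma\Rightarrow\Delta):=\{(\Lambda\Rightarrow\Theta)\in S:{\sf G}^{1}{\sf LC}^{cf}\vdash\Gamma,\Lambda\Rightarrow\Delta,\Theta\}$. Let $\mathbb{B}_S$ be the complete Boolean algebra induced by $M$ (described in the context). For formulas $A$ define $V(A)=(\Box V(A),\Diamond V(A))$ by \[ \Diamond V(A):=M(\Rightarrow A),\qquad \Box V(A):=m(A\Rightarrow)=\bigcap\{M(\Gamma\Rightarrow\Delta):(A\Rightarrow)\in M(\Gamma\Rightarrow\Delta)\}. \] Then $V$ is a semi ${\tt D}\mathbb{B}_S$-valuation.
   Context: Language: a second-order language with no relation, function or constant symbols; first-order terms are first-order variables, $Tm_0$ is the set of them; $n$-ary second-order variables $X^n$; atomic formulas $X^n(t_1,\dots,t_n)$; connectives $\lnot,\lor,\land$, quantifiers $\exists x,\forall x,\exists X^n,\forall X^n$. An $n$-ary abstract is $\lambda\vec x.G$; $Tm_1^{(n)}$ is the set of them; $F(T)$ replaces each $X(\vec t)$ by $G(\vec t)$. Sequents $\Gamma\Rightarrow\Delta$ are pairs of finite sets of formulas; $\Gamma,\Lambda$ means $\Gamma\cup\Lambda$. ${\sf G}^{1}{\sf LC}^{cf}$: initial sequents $A,\Gamma\Rightarrow\Delta,A$ ($A$ atomic); rules (premise(s) / conclusion): $(L\lnot)$ $\lnot F,\Gamma\Rightarrow\Delta,F$ / $\lnot F,\Gamma\Rightarrow\Delta$; $(R\lnot)$ $F,\Gamma\Rightarrow\Delta,\lnot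 F$ / $\Gamma\Rightarrow\Delta,\lnot F$; $(L\lor)$ $F_0,F_0\lor F_1,\Gamma\Rightarrow\Delta$ and $F_1,F_0\lor F_1,\Gamma\Rightarrow\Delta$ / $F_0\lor F_1,\Gamma\Rightarrow\Delta$; $(R\lor)$ $\Gamma\Rightarrow\Delta,F_0\lor F_1,F_i$ / $\Gamma\Rightarrow\Delta,F_0\lor F_1$; $(L\land)$ $F_i,F_0\land F_1,\Gamma\Rightarrow\Delta$ / $F_0\land F_1,\Gamma\Rightarrow\Delta$; $(R\land)$ $\Gamma\Rightarrow\Delta,F_0\land F_1,F_0$ and $\Gamma\Rightarrow\Delta,F_0\land F_1,F_1$ / $\Gamma\Rightarrow\Delta,F_0\land F_1$; $(L\exists^0)$ $F(a),\exists xF(x),\Gamma\Rightarrow\Delta$ / $\exists xF(x),\Gamma\Rightarrow\Delta$; $(R\exists^0)$ $\Gamma\Rightarrow\Delta,\exists xF(x),F(t)$ / $\Gamma\Rightarrow\Delta,\exists xF(x)$; $(L\forall^0)$ $F(t),\forall xF(x),\Gamma\Rightarrow\Delta$ / $\forall xF(x),\Gamma\Rightarrow\Delta$; $(R\forall^0)$ $\Gamma\Rightarrow\Delta,\forall xF(x),F(a)$ / $\Gamma\Rightarrow\Delta,\forall xF(x)$; second-order versions $(L\exists^1),(R\exists^1),(L\forall^1),(R\forall^1)$ with arbitrary $T\in Tm_1^{(n)}$ in $(R\exists^1),(L\forall^1)$ and an eigenvariable $Y$ in $(L\exists^1),(R\forall^1)$; eigenvariables do not occur in the conclusion. No cut rule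 and no explicit structural rules. The induced algebra: $\mathbb{B}_S:=\{\alpha\subseteq S:\alpha=\bigcap\{M(x):x\in S,\ \alpha\subseteq M(x)\}\}$ ($\bigcap\emptyset:=S$); it is a complete Boolean algebra ordered by inclusion containing all $M(x)$, with $1=S$, meets given by intersections, $\sup_\lambda\alpha_\lambda=\bigcap\{\gamma\in\mathbb{B}_S:\bigcup_\lambda\alpha_\lambda\subseteq\gamma\}$ and complement $-\alpha=\bigcap\{M(x):x\in\alpha\}$; also $m(y):=\bigcap\{M(x):y\in M(x)\}=-M(y)$. For a complete Boolean algebra $\mathbb{B}$: ${\tt D}\mathbb{B}=\{(a,b)\in\mathbb{B}^2:a\leq b\}$, ${\tt a}=(\Box{\tt a},\Diamond{\tt a})$, $-{\tt a}=(-\Diamond{\tt a},-\Box{\tt a})$, ${\tt a}\unlhd{\tt b}$ iff $\Box{\tt a}\leq\Box{\tt b}$ and $\Diamond{\tt a}\geq\Diamond{\tt b}$, $\sup_<,\inf_<$ componentwise. A semi ${\tt D}\mathbb{B}$-valuation is a map $V$ from all formulas to ${\tt D}\mathbb{B}$ with $V(\lnot F)\unlhd -V(F)$, $V(F_0\lor F_1)\unlhd\sup_<\{V(F_0),V(F_1)\}$, $V(F_0\land F_1)\unlhd\inf_<\{V(F_0),V(F_1)\}$, $V(\exists xF(x))\unlhd\sup_<\{V(F(t)):t\in Tm_0\}$, $V(\forall xF(x))\unlhd\inf_<\{V(F(t)):t\in Tm_0\}$, $V(\exists X^nF(X))\unlhd\sup_<\{V(F(T)):T\in Tm_1^{(n)}\}$,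 $V(\forall X^nF(X))\unlhd\inf_<\{V(F(T)):T\in Tm_1^{(n)}\}$. -}

module Defs where

open import Level using (Level; 0ℓ) renaming (suc to lsuc)
open import Data.Nat using (ℕ; suc)
open import Data.Fin using (Fin; zero; suc)
open import Data.Vec using (Vec; []; _∷_; lookup; tabulate; map)
open import Data.List using (List; []; _∷_; _++_)
open import Data.List.Membership.Propositional using (_∈_)
open import Data.Product using (_×_; _,_; Σ)
open import Data.Sum using (_⊎_; inj₁; inj₂)
open import Data.Bool using (Bool; true; false)
open import Data.Empty using (⊥)
open import Relation.Nullary using (¬_)
open import Relation.Binary.PropositionalEquality using (_≡_)
open import Relation.Unary using (Pred; _⊆_; _≐_)

-- Syntax (well-scoped: bound variables are de Bruijn indices, free
-- variables are names).  Fm k Γ : formulas with k bound first-order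
-- variables in scope and bound second-order variables with arities Γ.

data Term (k : ℕ) : Set where
  fv : ℕ → Term k
  bv : Fin k → Term k

data Idx : List ℕ → ℕ → Set where
  here  : ∀ {n Γ} → Idx (n ∷ Γ) n
  there : ∀ {m n Γ} → Idx Γ n → Idx (m ∷ Γ) n

data SVar (Γ : List ℕ) (n : ℕ) : Set where
  sfv : ℕ → SVar Γ n
  sbv : Idx Γ n → SVar Γ n

data Fm (k : ℕ) (Γ : List ℕ) : Set where
  atom      : ∀ {n} → SVar Γ n → Vec (Term k) n → Fm k Γ
  ¬'_       : Fm k Γ → Fm k Γ
  _∨'_ _∧'_ : Fm k Γ → Fm k Γ → Fm k Γ
  ∃⁰ ∀⁰     : Fm (suc k) Γ → Fm k Γ
  ∃¹ ∀¹     : (n : ℕ) → Fm k (n ∷ Γ) → Fm k Γ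

Formula : Set
Formula = Fm 0 []

-- Tm_0 : first-order terms = (free) first-order variables
Tm0 : Set
Tm0 = ℕ

-- Tm_1^(n) : n-ary abstracts λx₁…xₙ.G  (G with the xᵢ as bound indices)
Tm1 : ℕ → Set
Tm1 n = Fm n []

wkT : ∀ {k} → Term k → Term (suc k)
wkT (fv a) = fv a
wkT (bv i) = bv (suc i)

substT : ∀ {k j} → (Fin k → Term j) → Term k → Term j
substT σ (fv a) = fv a
substT σ (bv i) = σ i

liftT : ∀ {k j} → (Fin k → Term j) → Fin (suc k) → Term (suc j)
liftT σ zero    = bv zero
liftT σ (suc i) = wkT (σ i)

substF : ∀ {k j Γ} → (Fin k → Term j) → Fm k Γ → Fm j Γ
substF σ (atom X ts) = atom X (map (substT σ) ts)
substF σ (¬' F)      = ¬' substF σ F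
substF σ (F ∨' G)    = substF σ F ∨' substF σ G
substF σ (F ∧' G)    = substF σ F ∧' substF σ G
substF σ (∃⁰ F)      = ∃⁰ (substF (liftT σ) F)
substF σ (∀⁰ F)      = ∀⁰ (substF (liftT σ) F)
substF σ (∃¹ n F)    = ∃¹ n (substF σ F)
substF σ (∀¹ n F)    = ∀¹ n (substF σ F)

liftR : ∀ {Γ Δ m} → (∀ {n} → Idx Γ n → Idx Δ n) → ∀ {n} → Idx (m ∷ Γ) n → Idx (m ∷ Δ) n
liftR ρ here      = here
liftR ρ (there i) = there (ρ i)

renSV : ∀ {Γ Δ n} → (∀ {m} → Idx Γ m → Idx Δ m) → SVar Γ n → SVar Δ n
renSV ρ (sfv a) = sfv a
renSV ρ (sbv i) = sbv (ρ i)

renS : ∀ {k Γ Δ} → (∀ {n} → Idx Γ n → Idx Δ n) → Fm k Γ → Fm k Δ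
renS ρ (atom X ts) = atom (renSV ρ X) ts
renS ρ (¬' F)      = ¬' renS ρ F
renS ρ (F ∨' G)    = renS ρ F ∨' renS ρ G
renS ρ (F ∧' G)    = renS ρ F ∧' renS ρ G
renS ρ (∃⁰ F)      = ∃⁰ (renS ρ F)
renS ρ (∀⁰ F)      = ∀⁰ (renS ρ F)
renS ρ (∃¹ n F)    = ∃¹ n (renS (liftR ρ) F)
renS ρ (∀¹ n F)    = ∀¹ n (renS (liftR ρ) F)

embed0 : ∀ {Δ n} → Idx [] n → Idx Δ n
embed0 ()

SSub : List ℕ → List ℕ → Set
SSub Γ Δ = ∀ {m} → Idx Γ m → SVar Δ m ⊎ Tm1 m

liftSS : ∀ {Γ Δ m} → SSub Γ Δ → SSub (m ∷ Γ) (m ∷ Δ)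
liftSS σ here = inj₁ (sbv here)
liftSS σ (there i) with σ i
... | inj₁ X = inj₁ (renSV there X)
... | inj₂ T = inj₂ T

applyAbs : ∀ {k Δ n} → SVar Δ n ⊎ Tm1 n → Vec (Term k) n → Fm k Δ
applyAbs (inj₁ X) ts = atom X ts
applyAbs (inj₂ G) ts = renS embed0 (substF (lookup ts) G)

substS : ∀ {k Γ Δ} → SSub Γ Δ → Fm k Γ → Fm k Δ
substS σ (atom (sfv a) ts) = atom (sfv a) ts
substS σ (atom (sbv i) ts) = applyAbs (σ i) ts
substS σ (¬' F)      = ¬' substS σ F
substS σ (F ∨' G)    = substS σ F ∨' substS σ G
substS σ (F ∧' G)    = substS σ F ∧' substS σ G
substS σ (∃⁰ F)      = ∃⁰ (substS σ F)
substS σ (∀⁰ F)      = ∀⁰ (substS σ F)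
substS σ (∃¹ n F)    = ∃¹ n (substS (liftSS σ) F)
substS σ (∀¹ n F)    = ∀¹ n (substS (liftSS σ) F)

inst0 : Fm 1 [] → Tm0 → Formula
inst0 F t = substF (λ _ → fv t) F

single : ∀ {n} → Tm1 n → SSub (n ∷ []) []
single T here = inj₂ T
single T (there ())

inst1 : ∀ {n} → Fm 0 (n ∷ []) → Tm1 n → Formula
inst1 F T = substS (single T) F

varAbs : (n b : ℕ) → Tm1 n
varAbs n b = atom (sfv b) (tabulate bv)

OccT : ∀ {k} → ℕ → Term k → Set
OccT a (fv b) = a ≡ b
OccT a (bv _) = ⊥

OccV : ∀ {k n} → ℕ → Vec (Term k) n → Set
OccV a []       = ⊥
OccV a (t ∷ ts) = OccT a t ⊎ OccV a ts

Occ0 : ∀ {k Γ} → ℕ → Fm k Γ → Set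
Occ0 a (atom X ts) = OccV a ts
Occ0 a (¬' F)      = Occ0 a F
Occ0 a (F ∨' G)    = Occ0 a F ⊎ Occ0 a G
Occ0 a (F ∧' G)    = Occ0 a F ⊎ Occ0 a G
Occ0 a (∃⁰ F)      = Occ0 a F
Occ0 a (∀⁰ F)      = Occ0 a F
Occ0 a (∃¹ n F)    = Occ0 a F
Occ0 a (∀¹ n F)    = Occ0 a F

Occ1 : ∀ {k Γ} → ℕ → ℕ → Fm k Γ → Set
Occ1 n b (atom {m} (sfv c) ts) = (m ≡ n) × (c ≡ b)
Occ1 n b (atom (sbv _) ts)     = ⊥
Occ1 n b (¬' F)      = Occ1 n b F
Occ1 n b (F ∨' G)    = Occ1 n b F ⊎ Occ1 n b G
Occ1 n b (F ∧' G)    = Occ1 n b F ⊎ Occ1 n b G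
Occ1 n b (∃⁰ F)      = Occ1 n b F
Occ1 n b (∀⁰ F)      = Occ1 n b F
Occ1 n b (∃¹ m F)    = Occ1 n b F
Occ1 n b (∀¹ m F)    = Occ1 n b F

Fresh0 : ℕ → List Formula → List Formula → Set
Fresh0 a Γ Δ = ∀ A → A ∈ Γ ++ Δ → ¬ Occ0 a A

Fresh1 : ℕ → ℕ → List Formula → List Formula → Set
Fresh1 n b Γ Δ = ∀ A → A ∈ Γ ++ Δ → ¬ Occ1 n b A

-- The cut-free calculus G¹LC^cf.  Sequents are pairs of finite sets of
-- formulas; they are represented by pairs of lists, and the rule 'conv'
-- identifies lists with the same underlying set (so derivability is a
-- property of the pair of sets).

_≈ₛ_ : List Formula → List Formula → Set
L ≈ₛ L' = ∀ A → (A ∈ L → A ∈ L') × (A ∈ L' → A ∈ L)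

infix 4 ⊢_⇒_
data ⊢_⇒_ : List Formula → List Formula → Set where
  conv : ∀ {Γ Δ Γ' Δ'} → Γ ≈ₛ Γ' → Δ ≈ₛ Δ' → ⊢ Γ ⇒ Δ → ⊢ Γ' ⇒ Δ'
  init : ∀ {n Γ Δ} (X : SVar [] n) (ts : Vec (Term 0) n) →
         ⊢ atom X ts ∷ Γ ⇒ atom X ts ∷ Δ
  L¬ : ∀ {F Γ Δ} → ⊢ (¬' F) ∷ Γ ⇒ F ∷ Δ → ⊢ (¬' F) ∷ Γ ⇒ Δ
  R¬ : ∀ {F Γ Δ} → ⊢ F ∷ Γ ⇒ (¬' F) ∷ Δ → ⊢ Γ ⇒ (¬' F) ∷ Δ
  L∨ : ∀ {F₀ F₁ Γ Δ} → ⊢ F₀ ∷ (F₀ ∨' F₁) ∷ Γ ⇒ Δ → ⊢ F₁ ∷ (F₀ ∨' F₁) ∷ Γ ⇒ Δ →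
       ⊢ (F₀ ∨' F₁) ∷ Γ ⇒ Δ
  R∨₀ : ∀ {F₀ F₁ Γ Δ} → ⊢ Γ ⇒ (F₀ ∨' F₁) ∷ F₀ ∷ Δ → ⊢ Γ ⇒ (F₀ ∨' F₁) ∷ Δ
  R∨₁ : ∀ {F₀ F₁ Γ Δ} → ⊢ Γ ⇒ (F₀ ∨' F₁) ∷ F₁ ∷ Δ → ⊢ Γ ⇒ (F₀ ∨' F₁) ∷ Δ
  L∧₀ : ∀ {F₀ F₁ Γ Δ} → ⊢ F₀ ∷ (F₀ ∧' F₁) ∷ Γ ⇒ Δ → ⊢ (F₀ ∧' F₁) ∷ Γ ⇒ Δ
  L∧₁ : ∀ {F₀ F₁ Γ Δ} → ⊢ F₁ ∷ (F₀ ∧' F₁) ∷ Γ ⇒ Δ → ⊢ (F₀ ∧' F₁) ∷ Γ ⇒ Δ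
  R∧ : ∀ {F₀ F₁ Γ Δ} → ⊢ Γ ⇒ (F₀ ∧' F₁) ∷ F₀ ∷ Δ → ⊢ Γ ⇒ (F₀ ∧' F₁) ∷ F₁ ∷ Δ →
       ⊢ Γ ⇒ (F₀ ∧' F₁) ∷ Δ
  L∃⁰ : ∀ {F Γ Δ} (a : Tm0) → Fresh0 a (∃⁰ F ∷ Γ) Δ →
        ⊢ inst0 F a ∷ ∃⁰ F ∷ Γ ⇒ Δ → ⊢ ∃⁰ F ∷ Γ ⇒ Δ
  R∃⁰ : ∀ {F Γ Δ} (t : Tm0) → ⊢ Γ ⇒ ∃⁰ F ∷ inst0 F t ∷ Δ → ⊢ Γ ⇒ ∃⁰ F ∷ Δ
  L∀⁰ : ∀ {F Γ Δ} (t : Tm0) → ⊢ inst0 F t ∷ ∀⁰ F ∷ Γ ⇒ Δ → ⊢ ∀⁰ F ∷ Γ ⇒ Δ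
  R∀⁰ : ∀ {F Γ Δ} (a : Tm0) → Fresh0 a Γ (∀⁰ F ∷ Δ) →
        ⊢ Γ ⇒ ∀⁰ F ∷ inst0 F a ∷ Δ → ⊢ Γ ⇒ ∀⁰ F ∷ Δ
  L∃¹ : ∀ {n F Γ Δ} (b : ℕ) → Fresh1 n b (∃¹ n F ∷ Γ) Δ →
        ⊢ inst1 F (varAbs n b) ∷ ∃¹ n F ∷ Γ ⇒ Δ → ⊢ ∃¹ n F ∷ Γ ⇒ Δ
  R∃¹ : ∀ {n F Γ Δ} (T : Tm1 n) → ⊢ Γ ⇒ ∃¹ n F ∷ inst1 F T ∷ Δ → ⊢ Γ ⇒ ∃¹ n F ∷ Δ
  L∀¹ : ∀ {n F Γ Δ} (T : Tm1 n) → ⊢ inst1 F T ∷ ∀¹ n F ∷ Γ ⇒ Δ → ⊢ ∀¹ n F ∷ Γ ⇒ Δ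
  R∀¹ : ∀ {n F Γ Δ} (b : ℕ) → Fresh1 n b Γ (∀¹ n F ∷ Δ) →
        ⊢ Γ ⇒ ∀¹ n F ∷ inst1 F (varAbs n b) ∷ Δ → ⊢ Γ ⇒ ∀¹ n F ∷ Δ

Sequent : Set
Sequent = List Formula × List Formula

M : Sequent → Pred Sequent 0ℓ
M (Γ , Δ) (Λ , Θ) = ⊢ Γ ++ Λ ⇒ Δ ++ Θ

closure : ∀ {ℓ} → Pred Sequent ℓ → Pred Sequent ℓ
closure α y = ∀ x → α ⊆ M x → M x y

InB : ∀ {ℓ} → Pred Sequent ℓ → Set ℓ
InB α = α ≐ closure α

compl : ∀ {ℓ} → Pred Sequent ℓ → Pred Sequent ℓ
compl α y = ∀ x → α x → M x y

supB : ∀ {I : Set} → (I → Pred Sequent 0ℓ) → Pred Sequent (lsuc 0ℓ)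
supB αs y = ∀ (γ : Pred Sequent 0ℓ) → InB γ → (∀ i → αs i ⊆ γ) → γ y

infB : ∀ {I : Set} → (I → Pred Sequent 0ℓ) → Pred Sequent 0ℓ
infB αs y = ∀ i → αs i y

record D (ℓ : Level) : Set (lsuc ℓ) where
  constructor ⟨_,_⟩
  field
    □ : Pred Sequent ℓ
    ◇ : Pred Sequent ℓ
open D public

InDB : ∀ {ℓ} → D ℓ → Set ℓ
InDB a = InB (□ a) × InB (◇ a) × (□ a ⊆ ◇ a)

negD : ∀ {ℓ} → D ℓ → D ℓ
negD a = ⟨ compl (◇ a) , compl (□ a) ⟩

infix 4 _⊴_
_⊴_ : ∀ {ℓ ℓ'} → D ℓ → D ℓ' → Set _
a ⊴ b = (□ a ⊆ □ b) × (◇ b ⊆ ◇ a)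

sup< : ∀ {I : Set} → (I → D 0ℓ) → D (lsuc 0ℓ)
sup< as = ⟨ supB (λ i → □ (as i)) , supB (λ i → ◇ (as i)) ⟩

inf< : ∀ {I : Set} → (I → D 0ℓ) → D 0ℓ
inf< as = ⟨ infB (λ i → □ (as i)) , infB (λ i → ◇ (as i)) ⟩

pair : ∀ {ℓ} {A : Set ℓ} → A → A → Bool → A
pair a b true  = a
pair a b false = b

record SemiValuation (V : Formula → D 0ℓ) : Set₁ where
  field
    inDB : ∀ A → InDB (V A)
    v¬   : ∀ F → V (¬' F) ⊴ negD (V F)
    v∨   : ∀ F₀ F₁ → V (F₀ ∨' F₁) ⊴ sup< (pair (V F₀) (V F₁))
    v∧   : ∀ F₀ F₁ → V (F₀ ∧' F₁) ⊴ inf< (pair (V F₀) (V F₁))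
    v∃⁰  : ∀ F → V (∃⁰ F) ⊴ sup< (λ (t : Tm0) → V (inst0 F t))
    v∀⁰  : ∀ F → V (∀⁰ F) ⊴ inf< (λ (t : Tm0) → V (inst0 F t))
    v∃¹  : ∀ n F → V (∃¹ n F) ⊴ sup< (λ (T : Tm1 n) → V (inst1 F T))
    v∀¹  : ∀ n F → V (∀¹ n F) ⊴ inf< (λ (T : Tm1 n) → V (inst1 F T))

m : Sequent → Pred Sequent 0ℓ
m y z = ∀ x → M x y → M x z

Vcan : Formula → D 0ℓ
Vcan A = ⟨ m (A ∷ [] , []) , M ([] , A ∷ []) ⟩

-- Once weakening and identity are available, every clause of a semi-valuation
-- is a single rule of G¹LC^cf. A sequent lies in m(A⇒) iff it lies in every
-- M(Γ⇒Δ) with ⊢ A,Γ⇒Δ, so the □-inequalities amount to left rules; the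
-- ◇-inequalities amount to right rules, using for suprema that M(⇒H) belongs
-- to 𝔹_S. Weakening is admissible because the eigenvariables of a derivation
-- can be renamed away from the added formulas; identity follows by induction
-- on the size of formulas.

module Submission where

open import Defs
open import Level using (0ℓ)
open import Data.Nat using (ℕ; suc; _≟_; _<_; _≤_; _⊔_; _+_; s≤s)
open import Data.Nat.Properties using (≤-refl; ≤-reflexive; ≤-trans; m≤m⊔n; m≤n⊔m; <-irrefl; m≤m+n; m≤n+m)
open import Data.Nat.Induction using (<-wellFounded)
open import Induction.WellFounded using (Acc; acc)
open import Data.Fin using (Fin; zero; suc)
open import Data.Vec using (Vec; []; _∷_; lookup) renaming (map to vmap)
open import Data.Vec.Properties using (lookup-map; tabulate-∘; map-id; map-∘) renaming (map-cong to vmap-cong)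
open import Data.List using (List; []; _∷_; _++_)
open import Data.List.Properties using (++-identityʳ)
open import Data.List.Membership.Propositional using (_∈_)
open import Data.List.Membership.Propositional.Properties using (∈-++⁺ˡ; ∈-++⁺ʳ)
open import Data.List.Relation.Unary.Any using (here; there)
open import Data.List.Relation.Binary.Subset.Propositional using () renaming (_⊆_ to _⊆ᴸ_)
open import Data.List.Relation.Binary.Subset.Propositional.Properties using (⊆-refl; xs⊆x∷xs; ∷⁺ʳ; ∈-∷⁺ʳ; ⊆-reflexive-↭)
open import Data.List.Relation.Binary.Permutation.Propositional using (_↭_; ↭-sym; ↭-reflexive)
open import Data.List.Relation.Binary.Permutation.Propositional.Properties using (∷↭∷ʳ)
open import Data.Product using (_,_; proj₁; proj₂)
open import Data.Sum as Sum using (_⊎_; inj₁; inj₂)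
open import Data.Unit using (⊤)
open import Data.Bool using (true; false)
open import Relation.Nullary using (¬_; yes; no; contradiction)
open import Relation.Unary using (_⊆_)
open import Relation.Binary.PropositionalEquality
open import Function using (_∘_)

record Renaming : Set where
  field
    ren₀ : ℕ → ℕ
    ren₁ : (arity : ℕ) → ℕ → ℕ
open Renaming

id-renaming : Renaming
id-renaming = record { ren₀ = λ x → x ; ren₁ = λ _ x → x }

renameᵗ : ∀ {k} → Renaming → Term k → Term k
renameᵗ ρ (fv a) = fv (ren₀ ρ a)
renameᵗ ρ (bv i) = bv i

renameˣ : ∀ {Γ n} → Renaming → SVar Γ n → SVar Γ n
renameˣ {n = n} ρ (sfv a) = sfv (ren₁ ρ n a)
renameˣ ρ (sbv i) = sbv i

rename : ∀ {k Γ} → Renaming → Fm k Γ → Fm k Γ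
rename ρ (atom X ts) = atom (renameˣ ρ X) (vmap (renameᵗ ρ) ts)
rename ρ (¬' F)      = ¬' rename ρ F
rename ρ (F ∨' G)    = rename ρ F ∨' rename ρ G
rename ρ (F ∧' G)    = rename ρ F ∧' rename ρ G
rename ρ (∃⁰ F)      = ∃⁰ (rename ρ F)
rename ρ (∀⁰ F)      = ∀⁰ (rename ρ F)
rename ρ (∃¹ n F)    = ∃¹ n (rename ρ F)
rename ρ (∀¹ n F)    = ∀¹ n (rename ρ F)

renameᵃ : ∀ {Δ m} → Renaming → SVar Δ m ⊎ Tm1 m → SVar Δ m ⊎ Tm1 m
renameᵃ ρ = Sum.map (renameˣ ρ) (rename ρ)

liftT-cong : ∀ {k j} {σ τ : Fin k → Term j} → (∀ i → σ i ≡ τ i) → ∀ i → liftT σ i ≡ liftT τ i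
liftT-cong e zero    = refl
liftT-cong e (suc i) = cong wkT (e i)

substF-cong : ∀ {k j Γ} {σ τ : Fin k → Term j} → (∀ i → σ i ≡ τ i) →
              (F : Fm k Γ) → substF σ F ≡ substF τ F
substF-cong {σ = σ} {τ} e (atom X ts) = cong (atom X) (vmap-cong substT-cong ts)
  where
  substT-cong : ∀ t → substT σ t ≡ substT τ t
  substT-cong (fv a) = refl
  substT-cong (bv i) = e i
substF-cong e (¬' F)   = cong ¬'_ (substF-cong e F)
substF-cong e (F ∨' G) = cong₂ _∨'_ (substF-cong e F) (substF-cong e G)
substF-cong e (F ∧' G) = cong₂ _∧'_ (substF-cong e F) (substF-cong e G)
substF-cong e (∃⁰ F)   = cong ∃⁰ (substF-cong (liftT-cong e) F)
substF-cong e (∀⁰ F)   = cong ∀⁰ (substF-cong (liftT-cong e) F)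
substF-cong e (∃¹ n F) = cong (∃¹ n) (substF-cong e F)
substF-cong e (∀¹ n F) = cong (∀¹ n) (substF-cong e F)

rename-liftT : ∀ {k j} (ρ : Renaming) (σ : Fin k → Term j) i →
               renameᵗ ρ (liftT σ i) ≡ liftT (λ i → renameᵗ ρ (σ i)) i
rename-liftT ρ σ zero = refl
rename-liftT ρ σ (suc i) with σ i
... | fv a = refl
... | bv x = refl

rename-substF : ∀ {k j Γ} (ρ : Renaming) (σ : Fin k → Term j) (F : Fm k Γ) →
                rename ρ (substF σ F) ≡ substF (λ i → renameᵗ ρ (σ i)) (rename ρ F)
rename-substF {k} {j} ρ σ (atom X ts) = cong (atom (renameˣ ρ X)) (begin
    vmap (renameᵗ ρ) (vmap (substT σ) ts)               ≡⟨ map-∘ _ _ ts ⟨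
    vmap (λ t → renameᵗ ρ (substT σ t)) ts              ≡⟨ vmap-cong commute ts ⟩
    vmap (λ t → substT σ′ (renameᵗ ρ t)) ts             ≡⟨ map-∘ _ _ ts ⟩
    vmap (substT σ′) (vmap (renameᵗ ρ) ts)              ∎)
  where
  open ≡-Reasoning
  σ′ : Fin k → Term j
  σ′ i = renameᵗ ρ (σ i)
  commute : ∀ t → renameᵗ ρ (substT σ t) ≡ substT σ′ (renameᵗ ρ t)
  commute (fv a) = refl
  commute (bv i) = refl
rename-substF ρ σ (¬' F)   = cong ¬'_ (rename-substF ρ σ F)
rename-substF ρ σ (F ∨' G) = cong₂ _∨'_ (rename-substF ρ σ F) (rename-substF ρ σ G)
rename-substF ρ σ (F ∧' G) = cong₂ _∧'_ (rename-substF ρ σ F) (rename-substF ρ σ G)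
rename-substF ρ σ (∃⁰ F)   =
  cong ∃⁰ (trans (rename-substF ρ (liftT σ) F) (substF-cong (rename-liftT ρ σ) (rename ρ F)))
rename-substF ρ σ (∀⁰ F)   =
  cong ∀⁰ (trans (rename-substF ρ (liftT σ) F) (substF-cong (rename-liftT ρ σ) (rename ρ F)))
rename-substF ρ σ (∃¹ n F) = cong (∃¹ n) (rename-substF ρ σ F)
rename-substF ρ σ (∀¹ n F) = cong (∀¹ n) (rename-substF ρ σ F)

rename-renS : ∀ {k Γ Δ} (ρ : Renaming) (θ : ∀ {n} → Idx Γ n → Idx Δ n) (F : Fm k Γ) →
              rename ρ (renS θ F) ≡ renS θ (rename ρ F)
rename-renS ρ θ (atom (sfv a) ts) = refl
rename-renS ρ θ (atom (sbv i) ts) = refl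
rename-renS ρ θ (¬' F)   = cong ¬'_ (rename-renS ρ θ F)
rename-renS ρ θ (F ∨' G) = cong₂ _∨'_ (rename-renS ρ θ F) (rename-renS ρ θ G)
rename-renS ρ θ (F ∧' G) = cong₂ _∧'_ (rename-renS ρ θ F) (rename-renS ρ θ G)
rename-renS ρ θ (∃⁰ F)   = cong ∃⁰ (rename-renS ρ θ F)
rename-renS ρ θ (∀⁰ F)   = cong ∀⁰ (rename-renS ρ θ F)
rename-renS ρ θ (∃¹ n F) = cong (∃¹ n) (rename-renS ρ (liftR θ) F)
rename-renS ρ θ (∀¹ n F) = cong (∀¹ n) (rename-renS ρ (liftR θ) F)

liftSS-cong : ∀ {Γ Δ n} {σ τ : SSub Γ Δ} → (∀ {m} (i : Idx Γ m) → σ i ≡ τ i) →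
              ∀ {m} (i : Idx (n ∷ Γ) m) → liftSS σ i ≡ liftSS τ i
liftSS-cong e here = refl
liftSS-cong {σ = σ} {τ} e (there i) with σ i | τ i | e i
... | inj₁ X | .(inj₁ X) | refl = refl
... | inj₂ T | .(inj₂ T) | refl = refl

substS-cong : ∀ {k Γ Δ} {σ τ : SSub Γ Δ} → (∀ {m} (i : Idx Γ m) → σ i ≡ τ i) →
              (F : Fm k Γ) → substS σ F ≡ substS τ F
substS-cong e (atom (sfv a) ts) = refl
substS-cong e (atom (sbv i) ts) = cong (λ T → applyAbs T ts) (e i)
substS-cong e (¬' F)   = cong ¬'_ (substS-cong e F)
substS-cong e (F ∨' G) = cong₂ _∨'_ (substS-cong e F) (substS-cong e G)
substS-cong e (F ∧' G) = cong₂ _∧'_ (substS-cong e F) (substS-cong e G)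
substS-cong e (∃⁰ F)   = cong ∃⁰ (substS-cong e F)
substS-cong e (∀⁰ F)   = cong ∀⁰ (substS-cong e F)
substS-cong e (∃¹ n F) = cong (∃¹ n) (substS-cong (liftSS-cong e) F)
substS-cong e (∀¹ n F) = cong (∀¹ n) (substS-cong (liftSS-cong e) F)

rename-liftSS : ∀ {Γ Δ n} (ρ : Renaming) (σ : SSub Γ Δ) {m} (i : Idx (n ∷ Γ) m) →
                renameᵃ ρ (liftSS σ i) ≡ liftSS (λ j → renameᵃ ρ (σ j)) i
rename-liftSS ρ σ here = refl
rename-liftSS ρ σ (there i) with σ i
... | inj₁ (sfv a) = refl
... | inj₁ (sbv x) = refl
... | inj₂ T       = refl

rename-applyAbs : ∀ {k Δ n} (ρ : Renaming) (T : SVar Δ n ⊎ Tm1 n) (ts : Vec (Term k) n) →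
                  rename ρ (applyAbs T ts) ≡ applyAbs (renameᵃ ρ T) (vmap (renameᵗ ρ) ts)
rename-applyAbs ρ (inj₁ X) ts = refl
rename-applyAbs ρ (inj₂ G) ts = begin
  rename ρ (renS embed0 (substF (lookup ts) G))                        ≡⟨ rename-renS ρ embed0 _ ⟩
  renS embed0 (rename ρ (substF (lookup ts) G))                        ≡⟨ cong (renS embed0) (rename-substF ρ (lookup ts) G) ⟩
  renS embed0 (substF (λ i → renameᵗ ρ (lookup ts i)) (rename ρ G))    ≡⟨ cong (renS embed0) (substF-cong lookup-rename (rename ρ G)) ⟩
  renS embed0 (substF (lookup (vmap (renameᵗ ρ) ts)) (rename ρ G))     ∎
  where
  open ≡-Reasoning
  lookup-rename : ∀ i → renameᵗ ρ (lookup ts i) ≡ lookup (vmap (renameᵗ ρ) ts) i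
  lookup-rename i = sym (lookup-map i (renameᵗ ρ) ts)

rename-substS : ∀ {k Γ Δ} (ρ : Renaming) (σ : SSub Γ Δ) (F : Fm k Γ) →
                rename ρ (substS σ F) ≡ substS (λ i → renameᵃ ρ (σ i)) (rename ρ F)
rename-substS ρ σ (atom (sfv a) ts) = refl
rename-substS ρ σ (atom (sbv i) ts) = rename-applyAbs ρ (σ i) ts
rename-substS ρ σ (¬' F)   = cong ¬'_ (rename-substS ρ σ F)
rename-substS ρ σ (F ∨' G) = cong₂ _∨'_ (rename-substS ρ σ F) (rename-substS ρ σ G)
rename-substS ρ σ (F ∧' G) = cong₂ _∧'_ (rename-substS ρ σ F) (rename-substS ρ σ G)
rename-substS ρ σ (∃⁰ F)   = cong ∃⁰ (rename-substS ρ σ F)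
rename-substS ρ σ (∀⁰ F)   = cong ∀⁰ (rename-substS ρ σ F)
rename-substS ρ σ (∃¹ n F) =
  cong (∃¹ n) (trans (rename-substS ρ (liftSS σ) F) (substS-cong (rename-liftSS ρ σ) (rename ρ F)))
rename-substS ρ σ (∀¹ n F) =
  cong (∀¹ n) (trans (rename-substS ρ (liftSS σ) F) (substS-cong (rename-liftSS ρ σ) (rename ρ F)))

rename-inst0 : ∀ (ρ : Renaming) F t → rename ρ (inst0 F t) ≡ inst0 (rename ρ F) (ren₀ ρ t)
rename-inst0 ρ F t = rename-substF ρ (λ _ → fv t) F

rename-inst1 : ∀ (ρ : Renaming) {n} (F : Fm 0 (n ∷ [])) (T : Tm1 n) →
               rename ρ (inst1 F T) ≡ inst1 (rename ρ F) (rename ρ T)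
rename-inst1 ρ {n} F T = trans (rename-substS ρ (single T) F) (substS-cong rename-single (rename ρ F))
  where
  rename-single : ∀ {m} (i : Idx (n ∷ []) m) → renameᵃ ρ (single T i) ≡ single (rename ρ T) i
  rename-single here = refl

rename-varAbs : ∀ (ρ : Renaming) n b → rename ρ (varAbs n b) ≡ varAbs n (ren₁ ρ n b)
rename-varAbs ρ n b = cong (atom (sfv (ren₁ ρ n b))) (sym (tabulate-∘ (renameᵗ ρ) bv))

renameᵛ-cong : ∀ {k n} {ρ ρ′ : Renaming} (ts : Vec (Term k) n) →
               (∀ x → OccV x ts → ren₀ ρ x ≡ ren₀ ρ′ x) →
               vmap (renameᵗ ρ) ts ≡ vmap (renameᵗ ρ′) ts
renameᵛ-cong []          e = refl
renameᵛ-cong (fv a ∷ ts) e = cong₂ _∷_ (cong fv (e a (inj₁ refl))) (renameᵛ-cong ts λ x o → e x (inj₂ o))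
renameᵛ-cong (bv i ∷ ts) e = cong (bv i ∷_) (renameᵛ-cong ts λ x o → e x (inj₂ o))

rename-cong : ∀ {k Γ} {ρ ρ′ : Renaming} (F : Fm k Γ) →
              (∀ x → Occ0 x F → ren₀ ρ x ≡ ren₀ ρ′ x) →
              (∀ n x → Occ1 n x F → ren₁ ρ n x ≡ ren₁ ρ′ n x) →
              rename ρ F ≡ rename ρ′ F
rename-cong (atom {n} (sfv c) ts) e₀ e₁ = cong₂ atom (cong sfv (e₁ n c (refl , refl))) (renameᵛ-cong ts e₀)
rename-cong (atom (sbv i) ts)     e₀ e₁ = cong (atom (sbv i)) (renameᵛ-cong ts e₀)
rename-cong (¬' F)   e₀ e₁ = cong ¬'_ (rename-cong F e₀ e₁)
rename-cong (F ∨' G) e₀ e₁ = cong₂ _∨'_ (rename-cong F (λ x o → e₀ x (inj₁ o)) (λ n x o → e₁ n x (inj₁ o)))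
                                         (rename-cong G (λ x o → e₀ x (inj₂ o)) (λ n x o → e₁ n x (inj₂ o)))
rename-cong (F ∧' G) e₀ e₁ = cong₂ _∧'_ (rename-cong F (λ x o → e₀ x (inj₁ o)) (λ n x o → e₁ n x (inj₁ o)))
                                         (rename-cong G (λ x o → e₀ x (inj₂ o)) (λ n x o → e₁ n x (inj₂ o)))
rename-cong (∃⁰ F)   e₀ e₁ = cong ∃⁰ (rename-cong F e₀ e₁)
rename-cong (∀⁰ F)   e₀ e₁ = cong ∀⁰ (rename-cong F e₀ e₁)
rename-cong (∃¹ n F) e₀ e₁ = cong (∃¹ n) (rename-cong F e₀ e₁)
rename-cong (∀¹ n F) e₀ e₁ = cong (∀¹ n) (rename-cong F e₀ e₁)

rename-id : ∀ {k Γ} (F : Fm k Γ) → rename id-renaming F ≡ F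
rename-id (atom X ts) = cong₂ atom (renameˣ-id X) (trans (vmap-cong renameᵗ-id ts) (map-id ts))
  where
  renameˣ-id : ∀ {Γ n} (X : SVar Γ n) → renameˣ id-renaming X ≡ X
  renameˣ-id (sfv a) = refl
  renameˣ-id (sbv i) = refl
  renameᵗ-id : ∀ {k} (t : Term k) → renameᵗ id-renaming t ≡ t
  renameᵗ-id (fv a) = refl
  renameᵗ-id (bv i) = refl
rename-id (¬' F)   = cong ¬'_ (rename-id F)
rename-id (F ∨' G) = cong₂ _∨'_ (rename-id F) (rename-id G)
rename-id (F ∧' G) = cong₂ _∧'_ (rename-id F) (rename-id G)
rename-id (∃⁰ F)   = cong ∃⁰ (rename-id F)
rename-id (∀⁰ F)   = cong ∀⁰ (rename-id F)
rename-id (∃¹ n F) = cong (∃¹ n) (rename-id F)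
rename-id (∀¹ n F) = cong (∀¹ n) (rename-id F)

_[_≔_] : ∀ {A : Set} → (ℕ → A) → ℕ → A → ℕ → A
(f [ a ≔ c ]) x with x ≟ a
... | yes _ = c
... | no _  = f x

update-same : ∀ {A : Set} (f : ℕ → A) a c → (f [ a ≔ c ]) a ≡ c
update-same f a c with a ≟ a
... | yes _  = refl
... | no a≢a = contradiction refl a≢a

update-other : ∀ {A : Set} (f : ℕ → A) {a} c {x} → x ≢ a → (f [ a ≔ c ]) x ≡ f x
update-other f {a} c {x} x≢a with x ≟ a
... | yes x≡a = contradiction x≡a x≢a
... | no _    = refl

_[_≔_]₀ : Renaming → ℕ → ℕ → Renaming
ρ [ a ≔ c ]₀ = record ρ { ren₀ = ren₀ ρ [ a ≔ c ] }

_[_,_≔_]₁ : Renaming → ℕ → ℕ → ℕ → Renaming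
ρ [ n , b ≔ c ]₁ = record ρ { ren₁ = ren₁ ρ [ n ≔ ren₁ ρ n [ b ≔ c ] ] }

rename-update₀ : ∀ {k Γ} ρ {a} c (F : Fm k Γ) → ¬ Occ0 a F → rename (ρ [ a ≔ c ]₀) F ≡ rename ρ F
rename-update₀ ρ c F a∉F =
  rename-cong F (λ x x∈F → update-other (ren₀ ρ) c λ { refl → a∉F x∈F }) (λ _ _ _ → refl)

rename-update₁ : ∀ {k Γ} ρ {n b} c (F : Fm k Γ) → ¬ Occ1 n b F → rename (ρ [ n , b ≔ c ]₁) F ≡ rename ρ F
rename-update₁ ρ {n} {b} c F b∉F = rename-cong F (λ _ _ → refl) unchanged
  where
  unchanged : ∀ m x → Occ1 m x F → ren₁ (ρ [ n , b ≔ c ]₁) m x ≡ ren₁ ρ m x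
  unchanged m x x∈F with m ≟ n
  ... | yes refl = update-other (ren₁ ρ n) c λ { refl → b∉F x∈F }
  ... | no _     = refl

rename-inst0-update : ∀ ρ {a} c F → ¬ Occ0 a (∃⁰ F) → rename (ρ [ a ≔ c ]₀) (inst0 F a) ≡ inst0 (rename ρ F) c
rename-inst0-update ρ {a} c F a∉F =
  trans (rename-inst0 (ρ [ a ≔ c ]₀) F a) (cong₂ inst0 (rename-update₀ ρ c F a∉F) (update-same (ren₀ ρ) a c))

rename-inst1-update : ∀ ρ {n b} c F → ¬ Occ1 n b (∃¹ n F) →
                      rename (ρ [ n , b ≔ c ]₁) (inst1 F (varAbs n b)) ≡ inst1 (rename ρ F) (varAbs n c)
rename-inst1-update ρ {n} {b} c F b∉F =
  trans (rename-inst1 (ρ [ n , b ≔ c ]₁) F (varAbs n b))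
        (cong₂ inst1 (rename-update₁ ρ c F b∉F) (trans (rename-varAbs (ρ [ n , b ≔ c ]₁) n b) (cong (varAbs n) renamed-b)))
  where
  renamed-b : ren₁ (ρ [ n , b ≔ c ]₁) n b ≡ c
  renamed-b rewrite update-same (ren₁ ρ) n (ren₁ ρ n [ b ≔ c ]) = update-same (ren₁ ρ n) b c

-- Fresh eigenvariables

boundᵗ : ∀ {k} → Term k → ℕ
boundᵗ (fv a) = suc a
boundᵗ (bv i) = 0

boundᵛ : ∀ {k n} → Vec (Term k) n → ℕ
boundᵛ []       = 0
boundᵛ (t ∷ ts) = boundᵗ t ⊔ boundᵛ ts

boundˣ : ∀ {Γ n} → SVar Γ n → ℕ
boundˣ (sfv c) = suc c
boundˣ (sbv i) = 0

bound : ∀ {k Γ} → Fm k Γ → ℕ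
bound (atom X ts) = boundˣ X ⊔ boundᵛ ts
bound (¬' F)      = bound F
bound (F ∨' G)    = bound F ⊔ bound G
bound (F ∧' G)    = bound F ⊔ bound G
bound (∃⁰ F)      = bound F
bound (∀⁰ F)      = bound F
bound (∃¹ n F)    = bound F
bound (∀¹ n F)    = bound F

boundᴸ : List Formula → ℕ
boundᴸ []      = 0
boundᴸ (A ∷ L) = bound A ⊔ boundᴸ L

<-⊔ˡ : ∀ {x a} b → x < a → x < a ⊔ b
<-⊔ˡ {a = a} b p = ≤-trans p (m≤m⊔n a b)

<-⊔ʳ : ∀ {x} a {b} → x < b → x < a ⊔ b
<-⊔ʳ a {b} p = ≤-trans p (m≤n⊔m a b)

occV-bound : ∀ {k n} x (ts : Vec (Term k) n) → OccV x ts → x < boundᵛ ts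
occV-bound x (fv a ∷ ts) (inj₁ refl) = <-⊔ˡ (boundᵛ ts) ≤-refl
occV-bound x (t ∷ ts)    (inj₂ p)    = <-⊔ʳ (boundᵗ t) (occV-bound x ts p)

occ0-bound : ∀ {k Γ} x (F : Fm k Γ) → Occ0 x F → x < bound F
occ0-bound x (atom X ts) p        = <-⊔ʳ (boundˣ X) (occV-bound x ts p)
occ0-bound x (¬' F)      p        = occ0-bound x F p
occ0-bound x (F ∨' G)    (inj₁ p) = <-⊔ˡ (bound G) (occ0-bound x F p)
occ0-bound x (F ∨' G)    (inj₂ p) = <-⊔ʳ (bound F) (occ0-bound x G p)
occ0-bound x (F ∧' G)    (inj₁ p) = <-⊔ˡ (bound G) (occ0-bound x F p)
occ0-bound x (F ∧' G)    (inj₂ p) = <-⊔ʳ (bound F) (occ0-bound x G p)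
occ0-bound x (∃⁰ F)      p        = occ0-bound x F p
occ0-bound x (∀⁰ F)      p        = occ0-bound x F p
occ0-bound x (∃¹ n F)    p        = occ0-bound x F p
occ0-bound x (∀¹ n F)    p        = occ0-bound x F p

occ1-bound : ∀ {k Γ} n x (F : Fm k Γ) → Occ1 n x F → x < bound F
occ1-bound n x (atom (sfv c) ts) (refl , refl) = <-⊔ˡ (boundᵛ ts) ≤-refl
occ1-bound n x (¬' F)      p        = occ1-bound n x F p
occ1-bound n x (F ∨' G)    (inj₁ p) = <-⊔ˡ (bound G) (occ1-bound n x F p)
occ1-bound n x (F ∨' G)    (inj₂ p) = <-⊔ʳ (bound F) (occ1-bound n x G p)
occ1-bound n x (F ∧' G)    (inj₁ p) = <-⊔ˡ (bound G) (occ1-bound n x F p)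
occ1-bound n x (F ∧' G)    (inj₂ p) = <-⊔ʳ (bound F) (occ1-bound n x G p)
occ1-bound n x (∃⁰ F)      p        = occ1-bound n x F p
occ1-bound n x (∀⁰ F)      p        = occ1-bound n x F p
occ1-bound n x (∃¹ m F)    p        = occ1-bound n x F p
occ1-bound n x (∀¹ m F)    p        = occ1-bound n x F p

bound-∈ : ∀ {A} L → A ∈ L → bound A ≤ boundᴸ L
bound-∈ (B ∷ L) (here refl) = m≤m⊔n (bound B) (boundᴸ L)
bound-∈ (B ∷ L) (there p)   = ≤-trans (bound-∈ L p) (m≤n⊔m (bound B) (boundᴸ L))

boundᴸ-fresh₀ : ∀ Γ Δ → Fresh0 (boundᴸ (Γ ++ Δ)) Γ Δ
boundᴸ-fresh₀ Γ Δ A A∈ occ = <-irrefl refl (≤-trans (occ0-bound _ A occ) (bound-∈ (Γ ++ Δ) A∈))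

boundᴸ-fresh₁ : ∀ n Γ Δ → Fresh1 n (boundᴸ (Γ ++ Δ)) Γ Δ
boundᴸ-fresh₁ n Γ Δ A A∈ occ = <-irrefl refl (≤-trans (occ1-bound n _ A occ) (bound-∈ (Γ ++ Δ) A∈))

L∃⁰-uniform : ∀ {F Γ Δ} → (∀ a → ⊢ inst0 F a ∷ ∃⁰ F ∷ Γ ⇒ Δ) → ⊢ ∃⁰ F ∷ Γ ⇒ Δ
L∃⁰-uniform {F} {Γ} {Δ} d = L∃⁰ _ (boundᴸ-fresh₀ (∃⁰ F ∷ Γ) Δ) (d _)

R∀⁰-uniform : ∀ {F Γ Δ} → (∀ a → ⊢ Γ ⇒ ∀⁰ F ∷ inst0 F a ∷ Δ) → ⊢ Γ ⇒ ∀⁰ F ∷ Δ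
R∀⁰-uniform {F} {Γ} {Δ} d = R∀⁰ _ (boundᴸ-fresh₀ Γ (∀⁰ F ∷ Δ)) (d _)

L∃¹-uniform : ∀ {n F Γ Δ} → (∀ b → ⊢ inst1 F (varAbs n b) ∷ ∃¹ n F ∷ Γ ⇒ Δ) → ⊢ ∃¹ n F ∷ Γ ⇒ Δ
L∃¹-uniform {n} {F} {Γ} {Δ} d = L∃¹ _ (boundᴸ-fresh₁ n (∃¹ n F ∷ Γ) Δ) (d _)

R∀¹-uniform : ∀ {n F Γ Δ} → (∀ b → ⊢ Γ ⇒ ∀¹ n F ∷ inst1 F (varAbs n b) ∷ Δ) → ⊢ Γ ⇒ ∀¹ n F ∷ Δ
R∀¹-uniform {n} {F} {Γ} {Δ} d = R∀¹ _ (boundᴸ-fresh₁ n Γ (∀¹ n F ∷ Δ)) (d _)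

-- Admissibility of renaming and weakening

≈ₛ-refl : ∀ {L} → L ≈ₛ L
≈ₛ-refl _ = (λ A∈ → A∈) , (λ A∈ → A∈)

absorb : ∀ {A L} → A ∈ L → (A ∷ L) ≈ₛ L
absorb A∈L _ = ∈-∷⁺ʳ A∈L ⊆-refl , there

absorbˡ : ∀ {A Γ Δ} → A ∈ Γ → ⊢ A ∷ Γ ⇒ Δ → ⊢ Γ ⇒ Δ
absorbˡ A∈Γ = conv (absorb A∈Γ) ≈ₛ-refl

absorbʳ : ∀ {A Γ Δ} → A ∈ Δ → ⊢ Γ ⇒ A ∷ Δ → ⊢ Γ ⇒ Δ
absorbʳ A∈Δ = conv ≈ₛ-refl (absorb A∈Δ)

axiom : ∀ {n Γ Δ} (X : SVar [] n) ts → atom X ts ∈ Γ → atom X ts ∈ Δ → ⊢ Γ ⇒ Δ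
axiom X ts A∈Γ A∈Δ = absorbˡ A∈Γ (absorbʳ A∈Δ (init X ts))

_⊆[_]_ : List Formula → Renaming → List Formula → Set
Γ ⊆[ ρ ] Γ′ = ∀ {A} → A ∈ Γ → rename ρ A ∈ Γ′

⊆[]-∷ : ∀ {ρ F F′ Γ Γ′} → rename ρ F ≡ F′ → Γ ⊆[ ρ ] Γ′ → (F ∷ Γ) ⊆[ ρ ] (F′ ∷ Γ′)
⊆[]-∷ e s (here refl) = here e
⊆[]-∷ e s (there A∈) = there (s A∈)

keep : ∀ {ρ F Γ Γ′} → Γ ⊆[ ρ ] Γ′ → (F ∷ Γ) ⊆[ ρ ] (rename ρ F ∷ Γ′)
keep = ⊆[]-∷ refl

skip : ∀ {ρ B Γ Γ′} → Γ ⊆[ ρ ] Γ′ → Γ ⊆[ ρ ] (B ∷ Γ′)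
skip s A∈ = there (s A∈)

tail : ∀ {ρ B Γ Γ′} → (B ∷ Γ) ⊆[ ρ ] Γ′ → Γ ⊆[ ρ ] Γ′
tail s A∈ = s (there A∈)

⊆[]-update₀ : ∀ {ρ a c Γ Γ′} → (∀ A → A ∈ Γ → ¬ Occ0 a A) → Γ ⊆[ ρ ] Γ′ → Γ ⊆[ ρ [ a ≔ c ]₀ ] Γ′
⊆[]-update₀ {ρ} {c = c} {Γ′ = Γ′} fresh s {A} A∈ = subst (_∈ Γ′) (sym (rename-update₀ ρ c A (fresh A A∈))) (s A∈)

⊆[]-update₁ : ∀ {ρ n b c Γ Γ′} → (∀ A → A ∈ Γ → ¬ Occ1 n b A) → Γ ⊆[ ρ ] Γ′ → Γ ⊆[ ρ [ n , b ≔ c ]₁ ] Γ′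
⊆[]-update₁ {ρ} {c = c} {Γ′ = Γ′} fresh s {A} A∈ = subst (_∈ Γ′) (sym (rename-update₁ ρ c A (fresh A A∈))) (s A∈)

-- Each eigenvariable a is redirected to an arbitrary c by ρ [ a ≔ c ], which is
-- harmless on the rest of the sequent because a does not occur there.
⊢-rename : ∀ {Γ Δ Γ′ Δ′} → ⊢ Γ ⇒ Δ → (ρ : Renaming) → Γ ⊆[ ρ ] Γ′ → Δ ⊆[ ρ ] Δ′ → ⊢ Γ′ ⇒ Δ′
⊢-rename (conv eΓ eΔ d) ρ l r = ⊢-rename d ρ (λ A∈ → l (proj₁ (eΓ _) A∈)) (λ A∈ → r (proj₁ (eΔ _) A∈))
⊢-rename (init X ts) ρ l r = axiom _ _ (l (here refl)) (r (here refl))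
⊢-rename (L¬ d)    ρ l r = absorbˡ (l (here refl)) (L¬ (⊢-rename d ρ (skip l) (keep r)))
⊢-rename (R¬ d)    ρ l r = absorbʳ (r (here refl)) (R¬ (⊢-rename d ρ (keep l) (skip r)))
⊢-rename (L∨ d e)  ρ l r = absorbˡ (l (here refl)) (L∨ (⊢-rename d ρ (keep (skip l)) r) (⊢-rename e ρ (keep (skip l)) r))
⊢-rename (R∨₀ d)   ρ l r = absorbʳ (r (here refl)) (R∨₀ (⊢-rename d ρ l (keep (keep (tail r)))))
⊢-rename (R∨₁ d)   ρ l r = absorbʳ (r (here refl)) (R∨₁ (⊢-rename d ρ l (keep (keep (tail r)))))
⊢-rename (L∧₀ d)   ρ l r = absorbˡ (l (here refl)) (L∧₀ (⊢-rename d ρ (keep (skip l)) r))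
⊢-rename (L∧₁ d)   ρ l r = absorbˡ (l (here refl)) (L∧₁ (⊢-rename d ρ (keep (skip l)) r))
⊢-rename (R∧ d e)  ρ l r =
  absorbʳ (r (here refl)) (R∧ (⊢-rename d ρ l (keep (keep (tail r)))) (⊢-rename e ρ l (keep (keep (tail r)))))
⊢-rename (R∃⁰ {F} t d) ρ l r =
  absorbʳ (r (here refl)) (R∃⁰ (ren₀ ρ t) (⊢-rename d ρ l (keep (⊆[]-∷ (rename-inst0 ρ F t) (tail r)))))
⊢-rename (L∀⁰ {F} t d) ρ l r =
  absorbˡ (l (here refl)) (L∀⁰ (ren₀ ρ t) (⊢-rename d ρ (⊆[]-∷ (rename-inst0 ρ F t) (skip l)) r))
⊢-rename (R∃¹ {F = F} T d) ρ l r =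
  absorbʳ (r (here refl)) (R∃¹ (rename ρ T) (⊢-rename d ρ l (keep (⊆[]-∷ (rename-inst1 ρ F T) (tail r)))))
⊢-rename (L∀¹ {F = F} T d) ρ l r =
  absorbˡ (l (here refl)) (L∀¹ (rename ρ T) (⊢-rename d ρ (⊆[]-∷ (rename-inst1 ρ F T) (skip l)) r))
⊢-rename (L∃⁰ {F} {Γ} a fr d) ρ l r = absorbˡ (l (here refl)) (L∃⁰-uniform λ c →
  ⊢-rename d (ρ [ a ≔ c ]₀)
    (⊆[]-∷ (rename-inst0-update ρ c F (fr _ (here refl))) (skip (⊆[]-update₀ (λ A → fr A ∘ ∈-++⁺ˡ) l)))
    (⊆[]-update₀ (λ A → fr A ∘ ∈-++⁺ʳ (∃⁰ F ∷ Γ)) r))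
⊢-rename (R∀⁰ {F} {Γ} a fr d) ρ l r = absorbʳ (r (here refl)) (R∀⁰-uniform λ c →
  ⊢-rename d (ρ [ a ≔ c ]₀)
    (⊆[]-update₀ (λ A → fr A ∘ ∈-++⁺ˡ) l)
    (⊆[]-∷ (rename-update₀ ρ c (∀⁰ F) a∉) (⊆[]-∷ (rename-inst0-update ρ c F a∉)
      (tail (⊆[]-update₀ (λ A → fr A ∘ ∈-++⁺ʳ Γ) r)))))
  where
  a∉ : ¬ Occ0 a (∀⁰ F)
  a∉ = fr _ (∈-++⁺ʳ Γ (here refl))
⊢-rename (L∃¹ {n} {F} {Γ} b fr d) ρ l r = absorbˡ (l (here refl)) (L∃¹-uniform λ c →
  ⊢-rename d (ρ [ n , b ≔ c ]₁)
    (⊆[]-∷ (rename-inst1-update ρ c F (fr _ (here refl))) (skip (⊆[]-update₁ (λ A → fr A ∘ ∈-++⁺ˡ) l)))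
    (⊆[]-update₁ (λ A → fr A ∘ ∈-++⁺ʳ (∃¹ n F ∷ Γ)) r))
⊢-rename (R∀¹ {n} {F} {Γ} b fr d) ρ l r = absorbʳ (r (here refl)) (R∀¹-uniform λ c →
  ⊢-rename d (ρ [ n , b ≔ c ]₁)
    (⊆[]-update₁ (λ A → fr A ∘ ∈-++⁺ˡ) l)
    (⊆[]-∷ (rename-update₁ ρ c (∀¹ n F) b∉) (⊆[]-∷ (rename-inst1-update ρ c F b∉)
      (tail (⊆[]-update₁ (λ A → fr A ∘ ∈-++⁺ʳ Γ) r)))))
  where
  b∉ : ¬ Occ1 n b (∀¹ n F)
  b∉ = fr _ (∈-++⁺ʳ Γ (here refl))

weaken : ∀ {Γ Δ Γ′ Δ′} → ⊢ Γ ⇒ Δ → Γ ⊆ᴸ Γ′ → Δ ⊆ᴸ Δ′ → ⊢ Γ′ ⇒ Δ′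
weaken {Γ′ = Γ′} {Δ′} d Γ⊆ Δ⊆ = ⊢-rename d id-renaming (unrenamed Γ⊆) (unrenamed Δ⊆)
  where
  unrenamed : ∀ {L L′} → L ⊆ᴸ L′ → L ⊆[ id-renaming ] L′
  unrenamed {L′ = L′} L⊆ {A} A∈ = subst (_∈ L′) (sym (rename-id A)) (L⊆ A∈)

below-head : ∀ {A B : Formula} {Γ} → (A ∷ Γ) ⊆ᴸ (A ∷ B ∷ Γ)
below-head = ∷⁺ʳ _ (xs⊆x∷xs _ _)

L¬′ : ∀ {F Γ Δ} → ⊢ Γ ⇒ F ∷ Δ → ⊢ (¬' F) ∷ Γ ⇒ Δ
L¬′ d = L¬ (weaken d (xs⊆x∷xs _ _) ⊆-refl)

R¬′ : ∀ {F Γ Δ} → ⊢ F ∷ Γ ⇒ Δ → ⊢ Γ ⇒ (¬' F) ∷ Δ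
R¬′ d = R¬ (weaken d ⊆-refl (xs⊆x∷xs _ _))

L∨′ : ∀ {F₀ F₁ Γ Δ} → ⊢ F₀ ∷ Γ ⇒ Δ → ⊢ F₁ ∷ Γ ⇒ Δ → ⊢ (F₀ ∨' F₁) ∷ Γ ⇒ Δ
L∨′ d e = L∨ (weaken d below-head ⊆-refl) (weaken e below-head ⊆-refl)

R∨₀′ : ∀ {F₀ F₁ Γ Δ} → ⊢ Γ ⇒ F₀ ∷ Δ → ⊢ Γ ⇒ (F₀ ∨' F₁) ∷ Δ
R∨₀′ d = R∨₀ (weaken d ⊆-refl (xs⊆x∷xs _ _))

R∨₁′ : ∀ {F₀ F₁ Γ Δ} → ⊢ Γ ⇒ F₁ ∷ Δ → ⊢ Γ ⇒ (F₀ ∨' F₁) ∷ Δ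
R∨₁′ d = R∨₁ (weaken d ⊆-refl (xs⊆x∷xs _ _))

L∧₀′ : ∀ {F₀ F₁ Γ Δ} → ⊢ F₀ ∷ Γ ⇒ Δ → ⊢ (F₀ ∧' F₁) ∷ Γ ⇒ Δ
L∧₀′ d = L∧₀ (weaken d below-head ⊆-refl)

L∧₁′ : ∀ {F₀ F₁ Γ Δ} → ⊢ F₁ ∷ Γ ⇒ Δ → ⊢ (F₀ ∧' F₁) ∷ Γ ⇒ Δ
L∧₁′ d = L∧₁ (weaken d below-head ⊆-refl)

R∧′ : ∀ {F₀ F₁ Γ Δ} → ⊢ Γ ⇒ F₀ ∷ Δ → ⊢ Γ ⇒ F₁ ∷ Δ → ⊢ Γ ⇒ (F₀ ∧' F₁) ∷ Δ
R∧′ d e = R∧ (weaken d ⊆-refl (xs⊆x∷xs _ _)) (weaken e ⊆-refl (xs⊆x∷xs _ _))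

L∃⁰′ : ∀ {F Γ Δ} → (∀ t → ⊢ inst0 F t ∷ Γ ⇒ Δ) → ⊢ ∃⁰ F ∷ Γ ⇒ Δ
L∃⁰′ d = L∃⁰-uniform λ a → weaken (d a) below-head ⊆-refl

R∃⁰′ : ∀ {F} t {Γ Δ} → ⊢ Γ ⇒ inst0 F t ∷ Δ → ⊢ Γ ⇒ ∃⁰ F ∷ Δ
R∃⁰′ t d = R∃⁰ t (weaken d ⊆-refl (xs⊆x∷xs _ _))

L∀⁰′ : ∀ {F} t {Γ Δ} → ⊢ inst0 F t ∷ Γ ⇒ Δ → ⊢ ∀⁰ F ∷ Γ ⇒ Δ
L∀⁰′ t d = L∀⁰ t (weaken d below-head ⊆-refl)

R∀⁰′ : ∀ {F Γ Δ} → (∀ t → ⊢ Γ ⇒ inst0 F t ∷ Δ) → ⊢ Γ ⇒ ∀⁰ F ∷ Δ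
R∀⁰′ d = R∀⁰-uniform λ a → weaken (d a) ⊆-refl (xs⊆x∷xs _ _)

L∃¹′ : ∀ {n F Γ Δ} → (∀ T → ⊢ inst1 F T ∷ Γ ⇒ Δ) → ⊢ ∃¹ n F ∷ Γ ⇒ Δ
L∃¹′ d = L∃¹-uniform λ b → weaken (d (varAbs _ b)) below-head ⊆-refl

R∃¹′ : ∀ {n F} (T : Tm1 n) {Γ Δ} → ⊢ Γ ⇒ inst1 F T ∷ Δ → ⊢ Γ ⇒ ∃¹ n F ∷ Δ
R∃¹′ T d = R∃¹ T (weaken d ⊆-refl (xs⊆x∷xs _ _))

L∀¹′ : ∀ {n F} (T : Tm1 n) {Γ Δ} → ⊢ inst1 F T ∷ Γ ⇒ Δ → ⊢ ∀¹ n F ∷ Γ ⇒ Δ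
L∀¹′ T d = L∀¹ T (weaken d below-head ⊆-refl)

R∀¹′ : ∀ {n F Γ Δ} → (∀ T → ⊢ Γ ⇒ inst1 F T ∷ Δ) → ⊢ Γ ⇒ ∀¹ n F ∷ Δ
R∀¹′ d = R∀¹-uniform λ b → weaken (d (varAbs _ b)) ⊆-refl (xs⊆x∷xs _ _)

-- Identity

size : ∀ {k Γ} → Fm k Γ → ℕ
size (atom X ts) = 1
size (¬' F)      = suc (size F)
size (F ∨' G)    = suc (size F + size G)
size (F ∧' G)    = suc (size F + size G)
size (∃⁰ F)      = suc (size F)
size (∀⁰ F)      = suc (size F)
size (∃¹ n F)    = suc (size F)
size (∀¹ n F)    = suc (size F)

size-substF : ∀ {k j Γ} (σ : Fin k → Term j) (F : Fm k Γ) → size (substF σ F) ≡ size F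
size-substF σ (atom X ts) = refl
size-substF σ (¬' F)      = cong suc (size-substF σ F)
size-substF σ (F ∨' G)    = cong₂ (λ a b → suc (a + b)) (size-substF σ F) (size-substF σ G)
size-substF σ (F ∧' G)    = cong₂ (λ a b → suc (a + b)) (size-substF σ F) (size-substF σ G)
size-substF σ (∃⁰ F)      = cong suc (size-substF (liftT σ) F)
size-substF σ (∀⁰ F)      = cong suc (size-substF (liftT σ) F)
size-substF σ (∃¹ n F)    = cong suc (size-substF σ F)
size-substF σ (∀¹ n F)    = cong suc (size-substF σ F)

size-renS : ∀ {k Γ Δ} (θ : ∀ {n} → Idx Γ n → Idx Δ n) (F : Fm k Γ) → size (renS θ F) ≡ size F
size-renS θ (atom X ts) = refl
size-renS θ (¬' F)      = cong suc (size-renS θ F)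
size-renS θ (F ∨' G)    = cong₂ (λ a b → suc (a + b)) (size-renS θ F) (size-renS θ G)
size-renS θ (F ∧' G)    = cong₂ (λ a b → suc (a + b)) (size-renS θ F) (size-renS θ G)
size-renS θ (∃⁰ F)      = cong suc (size-renS θ F)
size-renS θ (∀⁰ F)      = cong suc (size-renS θ F)
size-renS θ (∃¹ n F)    = cong suc (size-renS (liftR θ) F)
size-renS θ (∀¹ n F)    = cong suc (size-renS (liftR θ) F)

Atomic : ∀ {Δ m} → SVar Δ m ⊎ Tm1 m → Set
Atomic (inj₁ _) = ⊤
Atomic (inj₂ T) = size T ≡ 1

AtomicSSub : ∀ {Γ Δ} → SSub Γ Δ → Set
AtomicSSub {Γ} σ = ∀ {m} (i : Idx Γ m) → Atomic (σ i)

liftSS-atomic : ∀ {Γ Δ n} (σ : SSub Γ Δ) → AtomicSSub σ → AtomicSSub (liftSS {m = n} σ)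
liftSS-atomic σ atomic here = _
liftSS-atomic σ atomic (there i) with σ i | atomic i
... | inj₁ X | _ = _
... | inj₂ T | p = p

size-substS : ∀ {k Γ Δ} (σ : SSub Γ Δ) → AtomicSSub σ → (F : Fm k Γ) → size (substS σ F) ≡ size F
size-substS σ atomic (atom (sfv c) ts) = refl
size-substS σ atomic (atom (sbv i) ts) with σ i | atomic i
... | inj₁ X | _ = refl
... | inj₂ G | p = trans (size-renS embed0 (substF (lookup ts) G)) (trans (size-substF (lookup ts) G) p)
size-substS σ atomic (¬' F)   = cong suc (size-substS σ atomic F)
size-substS σ atomic (F ∨' G) = cong₂ (λ a b → suc (a + b)) (size-substS σ atomic F) (size-substS σ atomic G)
size-substS σ atomic (F ∧' G) = cong₂ (λ a b → suc (a + b)) (size-substS σ atomic F) (size-substS σ atomic G)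
size-substS σ atomic (∃⁰ F)   = cong suc (size-substS σ atomic F)
size-substS σ atomic (∀⁰ F)   = cong suc (size-substS σ atomic F)
size-substS σ atomic (∃¹ n F) = cong suc (size-substS (liftSS σ) (liftSS-atomic σ atomic) F)
size-substS σ atomic (∀¹ n F) = cong suc (size-substS (liftSS σ) (liftSS-atomic σ atomic) F)

size-inst0 : ∀ F t → size (inst0 F t) < size (∃⁰ F)
size-inst0 F t = s≤s (≤-reflexive (size-substF _ F))

size-inst1 : ∀ {n} (F : Fm 0 (n ∷ [])) b → size (inst1 F (varAbs n b)) < size (∃¹ n F)
size-inst1 {n} F b = s≤s (≤-reflexive (size-substS (single (varAbs n b)) atomic F))
  where
  atomic : AtomicSSub (single (varAbs n b))
  atomic here = refl

identity-acc : ∀ A → Acc _<_ (size A) → ∀ {Γ Δ} → A ∈ Γ → A ∈ Δ → ⊢ Γ ⇒ Δ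
identity-acc (atom X ts) _        l r = axiom X ts l r
identity-acc (¬' F)      (acc rs) l r =
  absorbʳ r (R¬ (absorbˡ (there l) (L¬ (identity-acc F (rs ≤-refl) (there (here refl)) (here refl)))))
identity-acc (F ∨' G)    (acc rs) l r = absorbˡ l (L∨
  (absorbʳ r (R∨₀ (identity-acc F (rs (s≤s (m≤m+n _ _))) (here refl) (there (here refl)))))
  (absorbʳ r (R∨₁ (identity-acc G (rs (s≤s (m≤n+m _ (size F)))) (here refl) (there (here refl))))))
identity-acc (F ∧' G)    (acc rs) l r = absorbʳ r (R∧
  (absorbˡ l (L∧₀ (identity-acc F (rs (s≤s (m≤m+n _ _))) (here refl) (there (here refl)))))
  (absorbˡ l (L∧₁ (identity-acc G (rs (s≤s (m≤n+m _ (size F)))) (here refl) (there (here refl))))))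
identity-acc (∃⁰ F)      (acc rs) l r = absorbˡ l (L∃⁰-uniform λ a →
  absorbʳ r (R∃⁰ a (identity-acc (inst0 F a) (rs (size-inst0 F a)) (here refl) (there (here refl)))))
identity-acc (∀⁰ F)      (acc rs) l r = absorbʳ r (R∀⁰-uniform λ a →
  absorbˡ l (L∀⁰ a (identity-acc (inst0 F a) (rs (size-inst0 F a)) (here refl) (there (here refl)))))
identity-acc (∃¹ n F)    (acc rs) l r = absorbˡ l (L∃¹-uniform λ b →
  absorbʳ r (R∃¹ (varAbs n b) (identity-acc (inst1 F (varAbs n b)) (rs (size-inst1 F b)) (here refl) (there (here refl)))))
identity-acc (∀¹ n F)    (acc rs) l r = absorbʳ r (R∀¹-uniform λ b →
  absorbˡ l (L∀¹ (varAbs n b) (identity-acc (inst1 F (varAbs n b)) (rs (size-inst1 F b)) (here refl) (there (here refl)))))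

identity : ∀ A {Γ Δ} → A ∈ Γ → A ∈ Δ → ⊢ Γ ⇒ Δ
identity A = identity-acc A (<-wellFounded (size A))

[_⇒] : Formula → Sequent
[ A ⇒] = A ∷ [] , []

[⇒_] : Formula → Sequent
[⇒ A ] = [] , A ∷ []

↭⇒≈ₛ : ∀ {L L′} → L ↭ L′ → L ≈ₛ L′
↭⇒≈ₛ p _ = ⊆-reflexive-↭ p , ⊆-reflexive-↭ (↭-sym p)

M-[⇒]⁺ : ∀ {A Γ Δ} → ⊢ A ∷ Γ ⇒ Δ → M (Γ , Δ) [ A ⇒]
M-[⇒]⁺ {A} {Γ} {Δ} = conv (↭⇒≈ₛ (∷↭∷ʳ A Γ)) (↭⇒≈ₛ (↭-reflexive (sym (++-identityʳ Δ))))

M-[⇒]⁻ : ∀ {A Γ Δ} → M (Γ , Δ) [ A ⇒] → ⊢ A ∷ Γ ⇒ Δ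
M-[⇒]⁻ {A} {Γ} {Δ} = conv (↭⇒≈ₛ (↭-sym (∷↭∷ʳ A Γ))) (↭⇒≈ₛ (↭-reflexive (++-identityʳ Δ)))

M-InB : ∀ x → InB (M x)
M-InB x = (λ y∈ _ ⊆M → ⊆M y∈) , (λ y∈ → y∈ x (λ z∈ → z∈))

m-InB : ∀ y → InB (m y)
m-InB y = (λ z∈ _ ⊆M → ⊆M z∈) , (λ z∈ x y∈ → z∈ x (λ w∈ → w∈ x y∈))

m-refl : ∀ y → m y y
m-refl y _ y∈ = y∈

m-antitone : ∀ {G H} → (∀ {Γ Δ} → ⊢ G ∷ Γ ⇒ Δ → ⊢ H ∷ Γ ⇒ Δ) → m [ H ⇒] ⊆ m [ G ⇒]
m-antitone rule z∈ (Γ , Δ) G∈ = z∈ (Γ , Δ) (M-[⇒]⁺ (rule (M-[⇒]⁻ G∈)))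

m⊆M : ∀ A → m [ A ⇒] ⊆ M [⇒ A ]
m⊆M A z∈ = z∈ [⇒ A ] (identity A (here refl) (here refl))

neg-clause : ∀ {F H} → (∀ {Γ Δ} → ⊢ Γ ⇒ F ∷ Δ → ⊢ H ∷ Γ ⇒ Δ) →
             (∀ {Γ Δ} → ⊢ F ∷ Γ ⇒ Δ → ⊢ Γ ⇒ H ∷ Δ) → Vcan H ⊴ negD (Vcan F)
neg-clause {F} left right =
  (λ { z∈ (Γ , Δ) x∈ → z∈ (Γ , Δ) (M-[⇒]⁺ (left x∈)) }) ,
  (λ { {Λ , Θ} z∈ → right (z∈ [ F ⇒] (m-refl [ F ⇒])) })

sup-clause : ∀ {I : Set} {v : I → D 0ℓ} {G : I → Formula} {H} → (∀ i → v i ≡ Vcan (G i)) →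
             (∀ {Γ Δ} → (∀ i → ⊢ G i ∷ Γ ⇒ Δ) → ⊢ H ∷ Γ ⇒ Δ) →
             (∀ i {Γ Δ} → ⊢ Γ ⇒ G i ∷ Δ → ⊢ Γ ⇒ H ∷ Δ) → Vcan H ⊴ sup< v
sup-clause {v = v} {G} {H} v≡ left right = □-bound , ◇-bound
  where
  G∈□ : ∀ i → □ (v i) [ G i ⇒]
  G∈□ i = subst (λ w → □ w [ G i ⇒]) (sym (v≡ i)) (m-refl [ G i ⇒])
  □-bound : m [ H ⇒] ⊆ supB (λ i → □ (v i))
  □-bound z∈ γ γ∈B ub = proj₂ γ∈B λ { (Γ , Δ) γ⊆M → z∈ (Γ , Δ) (M-[⇒]⁺ (left λ i → M-[⇒]⁻ (γ⊆M (ub i (G∈□ i))))) }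
  ◇-bound : supB (λ i → ◇ (v i)) ⊆ M [⇒ H ]
  ◇-bound z∈ = z∈ (M [⇒ H ]) (M-InB [⇒ H ])
    λ { i {Λ , Θ} y∈ → right i (subst (λ w → ◇ w (Λ , Θ)) (v≡ i) y∈) }

inf-clause : ∀ {I : Set} {v : I → D 0ℓ} {G : I → Formula} {H} → (∀ i → v i ≡ Vcan (G i)) →
             (∀ i {Γ Δ} → ⊢ G i ∷ Γ ⇒ Δ → ⊢ H ∷ Γ ⇒ Δ) →
             (∀ {Γ Δ} → (∀ i → ⊢ Γ ⇒ G i ∷ Δ) → ⊢ Γ ⇒ H ∷ Δ) → Vcan H ⊴ inf< v
inf-clause {v = v} v≡ left right =
  (λ {z} z∈ i → subst (λ w → □ w z) (sym (v≡ i)) (m-antitone (left i) z∈)) ,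
  (λ { {Λ , Θ} z∈ → right λ i → subst (λ w → ◇ w (Λ , Θ)) (v≡ i) (z∈ i) })

pair-Vcan : ∀ F₀ F₁ i → pair (Vcan F₀) (Vcan F₁) i ≡ Vcan (pair F₀ F₁ i)
pair-Vcan F₀ F₁ true  = refl
pair-Vcan F₀ F₁ false = refl

lemma4p6 : SemiValuation Vcan
lemma4p6 = record
  { inDB = λ A → m-InB [ A ⇒] , M-InB [⇒ A ] , m⊆M A
  ; v¬   = λ F → neg-clause L¬′ R¬′
  ; v∨   = λ F₀ F₁ → sup-clause (pair-Vcan F₀ F₁) (λ d → L∨′ (d true) (d false))
                                 λ { true → R∨₀′ ; false → R∨₁′ }
  ; v∧   = λ F₀ F₁ → inf-clause (pair-Vcan F₀ F₁) (λ { true → L∧₀′ ; false → L∧₁′ })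
                                 λ d → R∧′ (d true) (d false)
  ; v∃⁰  = λ F → sup-clause (λ _ → refl) L∃⁰′ R∃⁰′
  ; v∀⁰  = λ F → inf-clause (λ _ → refl) L∀⁰′ R∀⁰′
  ; v∃¹  = λ n F → sup-clause (λ _ → refl) L∃¹′ R∃¹′
  ; v∀¹  = λ n F → inf-clause (λ _ → refl) L∀¹′ R∀¹′
  }
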